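{- Let $p$ be a prime, $\gamma\in p\mathbb{Z}_p$ with $2|\gamma|_p<1$. Then $\mathcal{G}_\gamma=\frac{1}{|\gamma|_p}-1$ is the smallest positive integer $k$ such that \[ \mathbb{Z}_p=\{x_1+x_2+\cdots+x_k:\ x_i\in\mathcal{C}_\gamma,\ 1\le i\le k\}. \]
   Context: $\mathbb{Z}_p$ is the ring of $p$-adic integers and $|\cdot|_p$ the $p$-adic absolute value ($|x|_p=p^{ -v_p(x)}$). For $\gamma\in p\mathbb{Z}_p$ with $2|\gamma|_p<1$, the $p$-adic Cantor set is $\mathcal{C}_\gamma=\left\{\sum_{n=0}^\infty a_n\gamma^n:\ a_n\in\{0,\gamma-1\}\right\}\subseteq\mathbb{Z}_p$. -}

module Defs where

open import Data.Nat using (ℕ; zero; suc; _^_; _<_)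
open import Data.Integer as ℤ using (ℤ; +_; 0ℤ; 1ℤ)
open import Data.Integer.Divisibility using (_∣_)
open import Data.Fin using (Fin)
import Data.Fin as F
open import Data.Bool using (Bool; true; false)
open import Data.Product using (Σ; _×_; ∃)
open import Relation.Binary.PropositionalEquality using (_≡_; _≢_)

_≡_[mod_] : ℤ → ℤ → ℕ → Set
a ≡ b [mod N ] = (+ N) ∣ (a ℤ.- b)

-- The p-adic integers ℤ_p as the inverse limit of ℤ/p^n ℤ:
-- a compatible system of residues val n ∈ [0, p^n).
record Zp (p : ℕ) : Set where
  field
    val    : ℕ → ℕ
    bound  : ∀ n → val n < p ^ n
    compat : ∀ n → (+ val (suc n)) ≡ (+ val n) [mod p ^ n ]
open Zp public

_≈ₚ_ : {p : ℕ} → Zp p → Zp p → Set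
x ≈ₚ y = ∀ n → val x n ≡ val y n

-- v_p(γ) = v : p^v divides γ but p^(v+1) does not (so γ ≠ 0).
-- Then |γ|_p = p^(-v).
HasValuation : (p : ℕ) → Zp p → ℕ → Set
HasValuation p γ v = (val γ v ≡ 0) × (val γ (suc v) ≢ 0)

sumℕ< : ℕ → (ℕ → ℤ) → ℤ
sumℕ< zero    f = 0ℤ
sumℕ< (suc m) f = sumℕ< m f ℤ.+ f m

sumFin : (k : ℕ) → (Fin k → ℤ) → ℤ
sumFin zero    f = 0ℤ
sumFin (suc k) f = f F.zero ℤ.+ sumFin k (λ i → f (F.suc i))

digit : Bool → ℤ → ℤ
digit false c = 0ℤ
digit true  c = c

-- x ∈ 𝒞_γ : there are digits a_n ∈ {0, γ - 1} with x = Σ_n a_n γ^n.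
-- The infinite sum converges p-adically (γ ∈ pℤ_p); its residue mod p^m is
-- that of the partial sum over n < m, computed with any representative
-- of γ mod p^m (here val γ m).
InCantor : (p : ℕ) → Zp p → Zp p → Set
InCantor p γ x = Σ (ℕ → Bool) λ a → ∀ m →
  (+ val x m) ≡ sumℕ< m (λ n → digit (a n) ((+ val γ m) ℤ.- 1ℤ) ℤ.* ((+ val γ m) ℤ.^ n)) [mod p ^ m ]

IsSumOfCantor : (p : ℕ) → Zp p → ℕ → Zp p → Set
IsSumOfCantor p γ k x = Σ (Fin k → Zp p) λ xs →
  (∀ i → InCantor p γ (xs i)) ×
  (∀ m → (+ val x m) ≡ sumFin k (λ i → + val (xs i) m) [mod p ^ m ])

Covers : (p : ℕ) → Zp p → ℕ → Set
Covers p γ k = ∀ (x : Zp p) → IsSumOfCantor p γ k x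

{-# OPTIONS --safe #-}
-- Write q = p^v = 1/|γ|_p. Since γ ≡ 0 (mod q), every point of 𝒞_γ is congruent to 0 or to
-- γ - 1 ≡ -1 modulo q, so a sum of k such points is ≡ -c with c ≤ k; representing 1 forces
-- q ∣ c + 1, hence k ≥ q - 1.
-- Conversely γ = p^v·u with u a p-adic unit, so every x ∈ ℤ_p can be expanded as
-- x = Σ c_n (γ - 1) γ^n with digits 0 ≤ c_n < q: the digit c_n is the solution of a linear
-- congruence modulo q whose coefficient (γ - 1)·u^n is a unit. Writing c_n as the number of
-- i < q - 1 with i < c_n splits x into q - 1 points of 𝒞_γ, the i-th having digits [i < c_n].
module Submission where

open import Defs
open import Data.Nat using (ℕ; suc; _^_; _<_; _∸_)
open import Data.Nat.Primality using (Prime)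
open import Data.Product using (_×_)
open import Relation.Nullary using (¬_)
open import Relation.Binary.PropositionalEquality using (_≡_)

open import Data.Bool using (Bool; true; false; if_then_else_)
open import Data.Empty using (⊥-elim)
open import Data.Fin as Fin using (Fin; toℕ)
open import Data.Integer as ℤ using (ℤ; +_; 0ℤ; 1ℤ; -1ℤ; _+_; _*_; _-_; -_)
open import Data.Integer.DivMod using (_%ℕ_; _/ℕ_; n%ℕd<d; a≡a%ℕn+[a/ℕn]*n)
open import Data.Integer.Divisibility.Signed as ℤ∣ using (divides) renaming (_∣_ to _∣ℤ_)
import Data.Integer.Properties as ℤP
open import Data.Integer.Tactic.RingSolver using (solve-∀)
open import Data.Nat as ℕ using (zero; _≤_; z≤n; s≤s; NonZero; _<ᵇ_; _<?_)
open import Data.Nat.Coprimality using (Coprime; coprime-Bézout; coprime-divisor)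
open import Data.Nat.Divisibility as ℕ∣ using (_∣_)
open import Data.Nat.GCD using (module Bézout)
open import Data.Nat.Primality using (prime⇒irreducible; prime⇒nonZero; prime⇒nonTrivial)
import Data.Nat.Properties as ℕP
open import Data.Product using (Σ; _,_; proj₁; proj₂)
open import Data.Sum using (inj₁; inj₂)
open import Relation.Binary.Bundles using (Setoid)
open import Relation.Binary.PropositionalEquality using (refl; sym; trans; cong; cong₂; subst; module ≡-Reasoning)
import Relation.Binary.Reasoning.Setoid as SetoidReasoning
open import Relation.Nullary.Decidable using (does; dec-true; dec-false)

infix 4 _≋_[mod_]

-- The same congruence as Defs._≡_[mod_], with signed divisibility, and as a
-- record so that a and b can be inferred from a proof.
record _≋_[mod_] (a b : ℤ) (n : ℕ) : Set where
  constructor mk≋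
  field ≋⇒∣ : + n ∣ℤ a - b
open _≋_[mod_]

≡-mod⇒≋ : ∀ {a b n} → a ≡ b [mod n ] → a ≋ b [mod n ]
≡-mod⇒≋ a≡b = mk≋ (ℤ∣.∣ᵤ⇒∣ a≡b)

≋⇒≡-mod : ∀ {a b n} → a ≋ b [mod n ] → a ≡ b [mod n ]
≋⇒≡-mod a≋b = ℤ∣.∣⇒∣ᵤ (≋⇒∣ a≋b)

≋-by : ∀ {n a b e} → a - b ≡ e → + n ∣ℤ e → a ≋ b [mod n ]
≋-by {n} a-b≡e n∣e = mk≋ (subst (+ n ∣ℤ_) (sym a-b≡e) n∣e)

≋-refl : ∀ {n a} → a ≋ a [mod n ]
≋-refl {n} {a} = ≋-by (ℤP.+-inverseʳ a) (divides 0ℤ (sym (ℤP.*-zeroˡ (+ n))))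

≋-reflexive : ∀ {n a b} → a ≡ b → a ≋ b [mod n ]
≋-reflexive refl = ≋-refl

≋-sym : ∀ {n a b} → a ≋ b [mod n ] → b ≋ a [mod n ]
≋-sym {a = a} {b} (mk≋ n∣a-b) = ≋-by (identity a b) (ℤ∣.∣m⇒∣-m n∣a-b)
  where
  identity : ∀ a b → b - a ≡ - (a - b)
  identity = solve-∀

≋-trans : ∀ {n a b c} → a ≋ b [mod n ] → b ≋ c [mod n ] → a ≋ c [mod n ]
≋-trans {a = a} {b} {c} (mk≋ n∣a-b) (mk≋ n∣b-c) = ≋-by (identity a b c) (ℤ∣.∣m∣n⇒∣m+n n∣a-b n∣b-c)
  where
  identity : ∀ a b c → a - c ≡ (a - b) + (b - c)
  identity = solve-∀

≋-setoid : ℕ → Setoid _ _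
≋-setoid n = record
  { Carrier = ℤ
  ; _≈_ = λ a b → a ≋ b [mod n ]
  ; isEquivalence = record { refl = ≋-refl ; sym = ≋-sym ; trans = ≋-trans }
  }

module ≋-Reasoning (n : ℕ) = SetoidReasoning (≋-setoid n)

≋-+ : ∀ {n a a′ b b′} → a ≋ a′ [mod n ] → b ≋ b′ [mod n ] → a + b ≋ a′ + b′ [mod n ]
≋-+ {a = a} {a′} {b} {b′} (mk≋ n∣a) (mk≋ n∣b) = ≋-by (identity a a′ b b′) (ℤ∣.∣m∣n⇒∣m+n n∣a n∣b)
  where
  identity : ∀ a a′ b b′ → (a + b) - (a′ + b′) ≡ (a - a′) + (b - b′)
  identity = solve-∀

≋-- : ∀ {n a a′ b b′} → a ≋ a′ [mod n ] → b ≋ b′ [mod n ] → a - b ≋ a′ - b′ [mod n ]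
≋-- {a = a} {a′} {b} {b′} (mk≋ n∣a) (mk≋ n∣b) = ≋-by (identity a a′ b b′) (ℤ∣.∣m∣n⇒∣m-n n∣a n∣b)
  where
  identity : ∀ a a′ b b′ → (a - b) - (a′ - b′) ≡ (a - a′) - (b - b′)
  identity = solve-∀

≋-* : ∀ {n a a′ b b′} → a ≋ a′ [mod n ] → b ≋ b′ [mod n ] → a * b ≋ a′ * b′ [mod n ]
≋-* {a = a} {a′} {b} {b′} (mk≋ n∣a) (mk≋ n∣b) =
  ≋-by (identity a a′ b b′) (ℤ∣.∣m∣n⇒∣m+n (ℤ∣.∣n⇒∣m*n a n∣b) (ℤ∣.∣m⇒∣m*n b′ n∣a))
  where
  identity : ∀ a a′ b b′ → a * b - a′ * b′ ≡ a * (b - b′) + (a - a′) * b′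
  identity = solve-∀

≋-^ : ∀ {n a a′} → a ≋ a′ [mod n ] → ∀ m → a ℤ.^ m ≋ a′ ℤ.^ m [mod n ]
≋-^ a≋a′ zero    = ≋-refl
≋-^ a≋a′ (suc m) = ≋-* a≋a′ (≋-^ a≋a′ m)

≋-weaken : ∀ {m n a b} → m ∣ n → a ≋ b [mod n ] → a ≋ b [mod m ]
≋-weaken m∣n (mk≋ n∣a-b) = mk≋ (ℤ∣.∣-trans (ℤ∣.∣ᵤ⇒∣ m∣n) n∣a-b)

≋-mod-1 : ∀ {a b} → a ≋ b [mod 1 ]
≋-mod-1 {a} {b} = mk≋ (divides (a - b) (sym (ℤP.*-identityʳ (a - b))))

≋-scale : ∀ {n a b} m → a ≋ b [mod n ] → a * + m ≋ b * + m [mod n ℕ.* m ]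
≋-scale {n} {a} {b} m (mk≋ n∣a-b) =
  ≋-by (identity a b (+ m)) (subst (_∣ℤ (a - b) * + m) (sym (ℤP.pos-* n m)) (ℤ∣.*-monoˡ-∣ (+ m) n∣a-b))
  where
  identity : ∀ a b m → a * m - b * m ≡ (a - b) * m
  identity = solve-∀

∣⇒≋0 : ∀ {n a} → + n ∣ℤ a → a ≋ 0ℤ [mod n ]
∣⇒≋0 {n} {a} n∣a = mk≋ (subst (+ n ∣ℤ_) (sym (ℤP.+-identityʳ a)) n∣a)

≋0⇒∣ : ∀ {n a} → a ≋ 0ℤ [mod n ] → + n ∣ℤ a
≋0⇒∣ {n} {a} (mk≋ n∣a-0) = subst (+ n ∣ℤ_) (ℤP.+-identityʳ a) n∣a-0

≋0⇒∣ℕ : ∀ {n a} → + a ≋ 0ℤ [mod n ] → n ∣ a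
≋0⇒∣ℕ a≋0 = ℤ∣.∣⇒∣ᵤ (≋0⇒∣ a≋0)

∣ℕ⇒≋0 : ∀ {n a} → n ∣ a → + a ≋ 0ℤ [mod n ]
∣ℕ⇒≋0 n∣a = ∣⇒≋0 (ℤ∣.∣ᵤ⇒∣ n∣a)

≋0-*ˡ : ∀ {n b} a → b ≋ 0ℤ [mod n ] → a * b ≋ 0ℤ [mod n ]
≋0-*ˡ a b≋0 = ∣⇒≋0 (ℤ∣.∣n⇒∣m*n a (≋0⇒∣ b≋0))

≋0-^ : ∀ {n a} → a ≋ 0ℤ [mod n ] → ∀ m → a ℤ.^ m ≋ 0ℤ [mod n ^ m ]
≋0-^ a≋0 zero = ≋-mod-1
≋0-^ {n} {a} a≋0 (suc m) = ∣⇒≋0 (subst (_∣ℤ a * a ℤ.^ m) (sym (ℤP.pos-* n (n ^ m)))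
  (ℤ∣.∣-trans (ℤ∣.*-monoˡ-∣ (+ (n ^ m)) (≋0⇒∣ a≋0)) (ℤ∣.*-monoʳ-∣ a (≋0⇒∣ (≋0-^ a≋0 m)))))

%ℕ-≋ : ∀ z n .{{_ : NonZero n}} → + (z %ℕ n) ≋ z [mod n ]
%ℕ-≋ z n = ≋-by (cong (λ w → + (z %ℕ n) - w) (a≡a%ℕn+[a/ℕn]*n z n)) (divides (- (z /ℕ n)) (identity (+ (z %ℕ n)) (z /ℕ n) (+ n)))
  where
  identity : ∀ r k n → r - (r + k * n) ≡ (- k) * n
  identity = solve-∀

digit-cong : ∀ {n a a′} b → a ≋ a′ [mod n ] → digit b a ≋ digit b a′ [mod n ]
digit-cong false a≋a′ = ≋-refl
digit-cong true  a≋a′ = a≋a′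

sumℕ<-cong : ∀ {n} m {f g : ℕ → ℤ} → (∀ j → f j ≋ g j [mod n ]) → sumℕ< m f ≋ sumℕ< m g [mod n ]
sumℕ<-cong zero    f≋g = ≋-refl
sumℕ<-cong (suc m) f≋g = ≋-+ (sumℕ<-cong m f≋g) (f≋g m)

sumℕ<-ext : ∀ m {f g : ℕ → ℤ} → (∀ j → j < m → f j ≡ g j) → sumℕ< m f ≡ sumℕ< m g
sumℕ<-ext zero    f≡g = refl
sumℕ<-ext (suc m) f≡g = cong₂ _+_ (sumℕ<-ext m (λ j j<m → f≡g j (ℕP.m<n⇒m<1+n j<m))) (f≡g m (ℕP.n<1+n m))

sumFin-cong : ∀ {n} k {f g : Fin k → ℤ} → (∀ i → f i ≋ g i [mod n ]) → sumFin k f ≋ sumFin k g [mod n ]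
sumFin-cong zero    f≋g = ≋-refl
sumFin-cong (suc k) f≋g = ≋-+ (f≋g Fin.zero) (sumFin-cong k (λ i → f≋g (Fin.suc i)))

sumFin-+ : ∀ k (f g : Fin k → ℤ) → sumFin k (λ i → f i + g i) ≡ sumFin k f + sumFin k g
sumFin-+ zero    f g = refl
sumFin-+ (suc k) f g = trans (cong (_+_ (f Fin.zero + g Fin.zero)) (sumFin-+ k _ _))
  (identity (f Fin.zero) (g Fin.zero) (sumFin k (λ i → f (Fin.suc i))) (sumFin k (λ i → g (Fin.suc i))))
  where
  identity : ∀ a b c d → (a + b) + (c + d) ≡ (a + c) + (b + d)
  identity = solve-∀

sumFin-0 : ∀ k → sumFin k (λ _ → 0ℤ) ≡ 0ℤ
sumFin-0 zero    = refl
sumFin-0 (suc k) = trans (ℤP.+-identityˡ _) (sumFin-0 k)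

sumFin-sumℕ<-comm : ∀ k m (f : Fin k → ℕ → ℤ) →
  sumFin k (λ i → sumℕ< m (f i)) ≡ sumℕ< m (λ n → sumFin k (λ i → f i n))
sumFin-sumℕ<-comm k zero    f = sumFin-0 k
sumFin-sumℕ<-comm k (suc m) f = trans (sumFin-+ k (λ i → sumℕ< m (f i)) (λ i → f i m))
  (cong (_+ sumFin k (λ i → f i m)) (sumFin-sumℕ<-comm k m f))

sumFin-indicator : ∀ k c a b → c ≤ k → sumFin k (λ i → digit (toℕ i <ᵇ c) a * b) ≡ + c * a * b
sumFin-indicator zero    zero    a b _         = refl
sumFin-indicator (suc k) zero    a b _         = trans (ℤP.+-identityˡ _) (sumFin-indicator k zero a b z≤n)
sumFin-indicator (suc k) (suc c) a b (s≤s c≤k) =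
  trans (cong (_+_ (a * b)) (sumFin-indicator k c a b c≤k)) (identity (+ c) a b)
  where
  identity : ∀ c a b → a * b + c * a * b ≡ (1ℤ + c) * a * b
  identity = solve-∀

sumFin-negated-digits : ∀ k (b : Fin k → Bool) → Σ ℕ λ c → c ≤ k × sumFin k (λ i → digit (b i) -1ℤ) ≡ - + c
sumFin-negated-digits zero    b = 0 , z≤n , refl
sumFin-negated-digits (suc k) b with sumFin-negated-digits k (λ i → b (Fin.suc i)) | b Fin.zero
... | c , c≤k , sum≡-c | true  = suc c , s≤s c≤k , trans (cong (_+_ -1ℤ) sum≡-c) (identity (+ c))
  where
  identity : ∀ c → -1ℤ + - c ≡ - (1ℤ + c)
  identity = solve-∀
... | c , c≤k , sum≡-c | false = c , ℕP.m≤n⇒m≤1+n c≤k , trans (ℤP.+-identityˡ _) sum≡-c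

pos-^ : ∀ a m → + (a ^ m) ≡ (+ a) ℤ.^ m
pos-^ a zero    = refl
pos-^ a (suc m) = trans (ℤP.pos-* a (a ^ m)) (cong (_*_ (+ a)) (pos-^ a m))

^-distribʳ-* : ∀ a b m → (a * b) ℤ.^ m ≡ a ℤ.^ m * b ℤ.^ m
^-distribʳ-* a b zero    = refl
^-distribʳ-* a b (suc m) = trans (cong (_*_ (a * b)) (^-distribʳ-* a b m)) (identity a b (a ℤ.^ m) (b ℤ.^ m))
  where
  identity : ∀ a b x y → (a * b) * (x * y) ≡ (a * x) * (b * y)
  identity = solve-∀

coprime-*ʳ : ∀ {m n o} → Coprime m n → Coprime m o → Coprime m (n ℕ.* o)
coprime-*ʳ m⊥n m⊥o (d∣m , d∣no) =
  m⊥o (d∣m , coprime-divisor (λ (e∣d , e∣n) → m⊥n (ℕ∣.∣-trans e∣d d∣m , e∣n)) d∣no)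

coprime-^ʳ : ∀ {m n} → Coprime m n → ∀ k → Coprime m (n ^ k)
coprime-^ʳ m⊥n zero    (_ , d∣1) = ℕ∣.∣1⇒≡1 d∣1
coprime-^ʳ m⊥n (suc k) = coprime-*ʳ m⊥n (coprime-^ʳ m⊥n k)

∤-prime⇒coprime : ∀ {p u} → Prime p → ¬ p ∣ u → Coprime u p
∤-prime⇒coprime p-prime p∤u {d} (d∣u , d∣p) with prime⇒irreducible p-prime d∣p
... | inj₁ d≡1 = d≡1
... | inj₂ d≡p = ⊥-elim (p∤u (subst (_∣ _) d≡p d∣u))

Invertible : ℕ → ℤ → Set
Invertible n a = Σ ℤ λ w → a * w ≋ 1ℤ [mod n ]

coprime⇒invertible : ∀ {u n} → Coprime u n → Invertible n (+ u)
coprime⇒invertible {u} {n} u⊥n with coprime-Bézout u⊥n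
... | Bézout.+- x y 1+yn≡xu = + x , ≋-by u*x-1≡y*n (divides (+ y) refl)
  where
  open ≡-Reasoning
  u*x-1≡y*n : + u * + x - 1ℤ ≡ + y * + n
  u*x-1≡y*n = begin
    + u * + x - 1ℤ            ≡⟨ cong (_- 1ℤ) (sym (ℤP.pos-* u x)) ⟩
    + (u ℕ.* x) - 1ℤ          ≡⟨ cong (λ z → + z - 1ℤ) (trans (ℕP.*-comm u x) (sym 1+yn≡xu)) ⟩
    1ℤ + + (y ℕ.* n) - 1ℤ     ≡⟨ identity (+ (y ℕ.* n)) ⟩
    + (y ℕ.* n)               ≡⟨ ℤP.pos-* y n ⟩
    + y * + n                 ∎
    where
    identity : ∀ a → 1ℤ + a - 1ℤ ≡ a
    identity = solve-∀
... | Bézout.-+ x y 1+xu≡yn = - + x , ≋-by u*-x-1≡-y*n (divides (- + y) refl)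
  where
  open ≡-Reasoning
  u*-x-1≡-y*n : + u * - + x - 1ℤ ≡ - + y * + n
  u*-x-1≡-y*n = begin
    + u * - + x - 1ℤ          ≡⟨ identity (+ u) (+ x) ⟩
    - (1ℤ + + x * + u)        ≡⟨ cong (λ z → - (1ℤ + z)) (sym (ℤP.pos-* x u)) ⟩
    - + (1 ℕ.+ x ℕ.* u)       ≡⟨ cong (λ z → - + z) 1+xu≡yn ⟩
    - + (y ℕ.* n)             ≡⟨ cong -_ (ℤP.pos-* y n) ⟩
    - (+ y * + n)             ≡⟨ ℤP.neg-distribˡ-* (+ y) (+ n) ⟩
    - + y * + n               ∎
    where
    identity : ∀ u x → u * - x - 1ℤ ≡ - (1ℤ + x * u)
    identity = solve-∀

invertible-* : ∀ {n a b} → Invertible n a → Invertible n b → Invertible n (a * b)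
invertible-* {a = a} {b} (w , aw≋1) (w′ , bw′≋1) =
  w * w′ , ≋-trans (≋-reflexive (identity a b w w′)) (≋-* aw≋1 bw′≋1)
  where
  identity : ∀ a b w w′ → (a * b) * (w * w′) ≡ (a * w) * (b * w′)
  identity = solve-∀

invertible-^ : ∀ {n a} → Invertible n a → ∀ m → Invertible n (a ℤ.^ m)
invertible-^ a-inv zero    = 1ℤ , ≋-refl {a = 1ℤ}
invertible-^ {a = a} a-inv (suc m) = invertible-* {a = a} {a ℤ.^ m} a-inv (invertible-^ a-inv m)

invertible-resp-≋ : ∀ {n a b} → a ≋ b [mod n ] → Invertible n b → Invertible n a
invertible-resp-≋ {a = a} {b} a≋b (w , bw≋1) = w , ≋-trans (≋-* {a = a} {b} a≋b (≋-refl {a = w})) bw≋1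

-1-invertible : ∀ {n} → Invertible n -1ℤ
-1-invertible {n} = -1ℤ , ≋-refl {n} {1ℤ}

solve-linear : ∀ n .{{_ : NonZero n}} {d} → Invertible n d → ∀ t → Σ ℕ λ c → c < n × + c * d ≋ t [mod n ]
solve-linear n {d} (w , dw≋1) t = (t * w) %ℕ n , n%ℕd<d (t * w) n , cd≋t
  where
  open ≋-Reasoning n
  cd≋t : + ((t * w) %ℕ n) * d ≋ t [mod n ]
  cd≋t = begin
    + ((t * w) %ℕ n) * d  ≈⟨ ≋-* (%ℕ-≋ (t * w) n) (≋-refl {a = d}) ⟩
    t * w * d             ≡⟨ ℤP.*-assoc t w d ⟩
    t * (w * d)           ≡⟨ cong (_*_ t) (ℤP.*-comm w d) ⟩
    t * (d * w)           ≈⟨ ≋-* (≋-refl {a = t}) dw≋1 ⟩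
    t * 1ℤ                ≡⟨ ℤP.*-identityʳ t ⟩
    t                     ∎

solve-linear-scaled : ∀ n .{{_ : NonZero n}} m {d r} → Invertible n d → + m ∣ℤ r →
  Σ ℕ λ c → c < n × r ≋ + c * d * + m [mod n ℕ.* m ]
solve-linear-scaled n m d-inv (divides t refl) with solve-linear n d-inv t
... | c , c<n , cd≋t = c , c<n , ≋-scale m (≋-sym cd≋t)

extend : {A : Set} → (ℕ → A) → ℕ → A → ℕ → A
extend f n a j = if does (j <? n) then f j else a

extend-< : ∀ {A : Set} (f : ℕ → A) n a {j} → j < n → extend f n a j ≡ f j
extend-< f n a {j} j<n rewrite dec-true (j <? n) j<n = refl

extend-≡ : ∀ {A : Set} (f : ℕ → A) n a → extend f n a n ≡ a
extend-≡ f n a rewrite dec-false (n <? n) (ℕP.<-irrefl refl) = refl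

module DependentChoice {A : Set} (Q : A → Set) (P : ℕ → (ℕ → A) → Set)
  (P-local : ∀ n {f g} → (∀ j → j < n → f j ≡ g j) → P n f → P n g)
  (f₀ : ℕ → A) (P₀ : P 0 f₀)
  (step : ∀ n f → P n f → Σ A λ a → Q a × P (suc n) (extend f n a)) where

  mutual
    approximant : ∀ n → Σ (ℕ → A) (P n)
    approximant zero    = f₀ , P₀
    approximant (suc n) = extend (proj₁ (approximant n)) n (proj₁ (choice n)) , proj₂ (proj₂ (choice n))

    choice : ∀ n → Σ A λ a → Q a × P (suc n) (extend (proj₁ (approximant n)) n a)
    choice n = step n (proj₁ (approximant n)) (proj₂ (approximant n))

  sequence : ℕ → A
  sequence n = proj₁ (choice n)

  sequence-Q : ∀ n → Q (sequence n)
  sequence-Q n = proj₁ (proj₂ (choice n))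

  approximant-prefix : ∀ n j → j < n → proj₁ (approximant n) j ≡ sequence j
  approximant-prefix (suc n) j j<1+n with ℕP.m≤n⇒m<n∨m≡n (ℕP.m<1+n⇒m≤n j<1+n)
  ... | inj₁ j<n  = trans (extend-< (proj₁ (approximant n)) n _ j<n) (approximant-prefix n j j<n)
  ... | inj₂ refl = extend-≡ (proj₁ (approximant n)) n _

  sequence-P : ∀ n → P n sequence
  sequence-P n = P-local n (approximant-prefix n) (proj₂ (approximant n))

partialSum : (ℕ → ℕ) → ℤ → ℕ → ℤ
partialSum c g n = sumℕ< n (λ j → + c j * (g - 1ℤ) * g ℤ.^ j)

partialSum-cong : ∀ {n g g′} c m → g ≋ g′ [mod n ] → partialSum c g m ≋ partialSum c g′ m [mod n ]
partialSum-cong {g = g} {g′} c m g≋g′ =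
  sumℕ<-cong m (λ j → ≋-* (≋-* (≋-refl {a = + c j}) (≋-- g≋g′ (≋-refl {a = 1ℤ}))) (≋-^ g≋g′ j))

partialSum-local : ∀ {c c′} g m → (∀ j → j < m → c j ≡ c′ j) → partialSum c g m ≡ partialSum c′ g m
partialSum-local g m c≡c′ = sumℕ<-ext m (λ j j<m → cong (λ z → + z * (g - 1ℤ) * g ℤ.^ j) (c≡c′ j j<m))

partialSum-extend : ∀ c g n d → partialSum (extend c n d) g (suc n) ≡ partialSum c g n + + d * (g - 1ℤ) * g ℤ.^ n
partialSum-extend c g n d = cong₂ _+_
  (partialSum-local g n (λ j j<n → extend-< c n d j<n))
  (cong (λ z → + z * (g - 1ℤ) * g ℤ.^ n) (extend-≡ c n d))

cantorTerm : Bool → ℤ → ℕ → ℤ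
cantorTerm b g n = digit b (g - 1ℤ) * g ℤ.^ n

cantorSum : (ℕ → Bool) → ℤ → ℕ → ℤ
cantorSum a g m = sumℕ< m (λ n → cantorTerm (a n) g n)

cantorSum-cong : ∀ {n g g′} a m → g ≋ g′ [mod n ] → cantorSum a g m ≋ cantorSum a g′ m [mod n ]
cantorSum-cong a m g≋g′ = sumℕ<-cong m (λ j → ≋-* (digit-cong (a j) (≋-- g≋g′ (≋-refl {a = 1ℤ}))) (≋-^ g≋g′ j))

cantorSum-0 : ∀ a m .{{_ : NonZero m}} → cantorSum a 0ℤ m ≡ digit (a 0) -1ℤ
cantorSum-0 a (suc zero)    = trans (ℤP.+-identityˡ _) (ℤP.*-identityʳ _)
cantorSum-0 a (suc (suc m)) = trans (cong₂ _+_ (cantorSum-0 a (suc m)) (ℤP.*-zeroʳ (digit (a (suc m)) -1ℤ)))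
  (ℤP.+-identityʳ _)

cantorSum-indicator : ∀ k (c : ℕ → ℕ) g m → (∀ n → c n ≤ k) →
  sumFin k (λ i → cantorSum (λ n → toℕ i <ᵇ c n) g m) ≡ partialSum c g m
cantorSum-indicator k c g m c≤k = trans (sumFin-sumℕ<-comm k m _)
  (sumℕ<-ext m (λ n _ → sumFin-indicator k (c n) (g - 1ℤ) (g ℤ.^ n) (c≤k n)))

^-monoʳ-∣ : ∀ p {m n} → m ≤ n → p ^ m ∣ p ^ n
^-monoʳ-∣ p {m} {n} m≤n =
  ℕ∣.divides (p ^ (n ∸ m)) (trans (cong (p ^_) (sym (ℕP.m∸n+n≡m m≤n))) (ℕP.^-distribˡ-+-* p (n ∸ m) m))

val-stable : ∀ {p} (z : Zp p) {m} M → m ≤ M → + val z M ≋ + val z m [mod p ^ m ]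
val-stable z zero    z≤n    = ≋-refl
val-stable {p} z (suc M) m≤1+M with ℕP.m≤n⇒m<n∨m≡n m≤1+M
... | inj₁ m<1+M = let m≤M = ℕP.m<1+n⇒m≤n m<1+M in
  ≋-trans (≋-weaken (^-monoʳ-∣ p m≤M) (≡-mod⇒≋ (compat z M))) (val-stable z M m≤M)
... | inj₂ refl  = ≋-refl

module CantorPoints {p : ℕ} .{{_ : NonZero p}} (γ : Zp p) (p∣γ : val γ 1 ≡ 0) where

  _mod-p^_ : ℤ → ℕ → ℕ
  z mod-p^ m = _%ℕ_ z (p ^ m) {{ℕP.m^n≢0 p m}}

  mod-p^-≋ : ∀ z m → + (z mod-p^ m) ≋ z [mod p ^ m ]
  mod-p^-≋ z m = %ℕ-≋ z (p ^ m) {{ℕP.m^n≢0 p m}}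

  γ-multiple-of-p : ∀ m → + val γ (suc m) ≋ 0ℤ [mod p ]
  γ-multiple-of-p m = ≋-weaken (ℕ∣.m∣m*n 1)
    (subst (λ r → + val γ (suc m) ≋ + r [mod p ^ 1 ]) p∣γ (val-stable γ (suc m) (s≤s z≤n)))

  cantorPoint : (ℕ → Bool) → Zp p
  cantorPoint a = record
    { val    = λ m → cantorSum a (+ val γ m) m mod-p^ m
    ; bound  = λ m → n%ℕd<d (cantorSum a (+ val γ m) m) (p ^ m) {{ℕP.m^n≢0 p m}}
    ; compat = λ m → ≋⇒≡-mod (residues-compatible m)
    }
    where
    residue : ℕ → ℤ
    residue m = + (cantorSum a (+ val γ m) m mod-p^ m)

    -- The new term has the factor γ^m ≡ 0 (mod p^m).
    residues-compatible : ∀ m → residue (suc m) ≋ residue m [mod p ^ m ]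
    residues-compatible m = begin
      residue (suc m)
        ≈⟨ ≋-weaken (^-monoʳ-∣ p (ℕP.n≤1+n m)) (mod-p^-≋ (cantorSum a g′ (suc m)) (suc m)) ⟩
      cantorSum a g′ m + cantorTerm (a m) g′ m
        ≈⟨ ≋-+ (cantorSum-cong a m (val-stable γ (suc m) (ℕP.n≤1+n m)))
               (≋0-*ˡ (digit (a m) (g′ - 1ℤ)) (≋0-^ (γ-multiple-of-p m) m)) ⟩
      cantorSum a (+ val γ m) m + 0ℤ
        ≡⟨ ℤP.+-identityʳ _ ⟩
      cantorSum a (+ val γ m) m
        ≈⟨ mod-p^-≋ (cantorSum a (+ val γ m) m) m ⟨
      residue m ∎
      where
      open ≋-Reasoning (p ^ m)
      g′ : ℤ
      g′ = + val γ (suc m)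

  cantorPoint-val : ∀ a m → + val (cantorPoint a) m ≋ cantorSum a (+ val γ m) m [mod p ^ m ]
  cantorPoint-val a m = mod-p^-≋ (cantorSum a (+ val γ m) m) m

  cantorPoint∈𝒞 : ∀ a → InCantor p γ (cantorPoint a)
  cantorPoint∈𝒞 a = a , λ m → ≋⇒≡-mod (cantorPoint-val a m)

1ₚ : ∀ {p} → 1 < p → Zp p
1ₚ {p} 1<p = record { val = val₁ ; bound = bound₁ ; compat = compat₁ }
  where
  val₁ : ℕ → ℕ
  val₁ zero    = 0
  val₁ (suc _) = 1

  bound₁ : ∀ n → val₁ n < p ^ n
  bound₁ zero    = s≤s z≤n
  bound₁ (suc n) = ℕP.*-mono-≤ 1<p (ℕP.m^n>0 p {{ℕ.>-nonZero (ℕP.<-trans (s≤s z≤n) 1<p)}} n)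

  compat₁ : ∀ n → (+ val₁ (suc n)) ≡ (+ val₁ n) [mod p ^ n ]
  compat₁ zero    = ≋⇒≡-mod (≋-mod-1 {+ 1} {+ 0})
  compat₁ (suc n) = ≋⇒≡-mod (≋-refl {a = + 1})

1ₚ-val : ∀ {p} (1<p : 1 < p) n .{{_ : NonZero n}} → val (1ₚ 1<p) n ≡ 1
1ₚ-val 1<p (suc n) = refl

module LowerBound {p : ℕ} (1<p : 1 < p) (γ : Zp p) (v : ℕ) .{{_ : NonZero v}} (γ≡0 : val γ v ≡ 0) where

  cantor-residue : ∀ {x} (x∈𝒞 : InCantor p γ x) → + val x v ≋ digit (proj₁ x∈𝒞 0) -1ℤ [mod p ^ v ]
  cantor-residue (a , x≡sum) = ≋-trans (≡-mod⇒≋ (x≡sum v))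
    (≋-reflexive (trans (cong (λ g → cantorSum a (+ g) v) γ≡0) (cantorSum-0 a v)))

  ¬covers : ∀ k → k < p ^ v ∸ 1 → ¬ Covers p γ k
  ¬covers k k<q-1 cover with cover (1ₚ 1<p)
  ... | xs , xs∈𝒞 , 1≡sum with sumFin-negated-digits k (λ i → proj₁ (xs∈𝒞 i) 0)
  ... | c , c≤k , sum≡-c = ℕP.<⇒≱ (ℕP.≤-<-trans (s≤s c≤k) (<∸1⇒1+< k<q-1)) (ℕ∣.∣⇒≤ q∣1+c)
    where
    1≋-c : 1ℤ ≋ - + c [mod p ^ v ]
    1≋-c = begin
      1ℤ                                      ≡⟨ cong +_ (1ₚ-val 1<p v) ⟨
      + val (1ₚ 1<p) v                        ≈⟨ ≡-mod⇒≋ (1≡sum v) ⟩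
      sumFin k (λ i → + val (xs i) v)         ≈⟨ sumFin-cong k (λ i → cantor-residue {xs i} (xs∈𝒞 i)) ⟩
      sumFin k (λ i → digit (proj₁ (xs∈𝒞 i) 0) -1ℤ) ≡⟨ sum≡-c ⟩
      - + c                                   ∎
      where open ≋-Reasoning (p ^ v)

    q∣1+c : p ^ v ∣ suc c
    q∣1+c = ≋0⇒∣ℕ (≋-trans (≋-+ 1≋-c (≋-refl {a = + c})) (≋-reflexive (ℤP.+-inverseˡ (+ c))))

    <∸1⇒1+< : ∀ {k q} → k < q ∸ 1 → suc k < q
    <∸1⇒1+< {q = suc q} k<q = s≤s k<q

module Expansion {p : ℕ} (p-prime : Prime p) (γ : Zp p) (v : ℕ) .{{_ : NonZero v}}
  (γ-valuation : HasValuation p γ v) (p∣γ : val γ 1 ≡ 0) where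

  instance
    p-nonZero : NonZero p
    p-nonZero = prime⇒nonZero p-prime

  q : ℕ
  q = p ^ v

  instance
    q-nonZero : NonZero q
    q-nonZero = ℕP.m^n≢0 p v

  open CantorPoints γ p∣γ

  q∣γ : ∀ {N} → v ≤ N → + val γ N ≋ 0ℤ [mod q ]
  q∣γ {N} v≤N = subst (λ r → + val γ N ≋ + r [mod q ]) (proj₁ γ-valuation) (val-stable γ N v≤N)

  γ-unit-part : ∀ N → suc v ≤ N → Σ ℕ λ u → val γ N ≡ u ℕ.* q × ¬ p ∣ u
  γ-unit-part N v<N with ≋0⇒∣ℕ (q∣γ (ℕP.<⇒≤ v<N))
  ... | ℕ∣.divides u γ≡uq = u , γ≡uq , p∤u
    where
    p∤u : ¬ p ∣ u
    p∤u p∣u = ℕ∣.>⇒∤ {{ℕ.≢-nonZero (proj₂ γ-valuation)}} (bound γ (suc v)) p^[1+v]∣γ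
      where
      p^[1+v]∣γN : + val γ N ≋ 0ℤ [mod p ^ suc v ]
      p^[1+v]∣γN = ∣ℕ⇒≋0 (subst (p ^ suc v ∣_) (sym γ≡uq) (ℕ∣.*-monoˡ-∣ q p∣u))

      p^[1+v]∣γ : p ^ suc v ∣ val γ (suc v)
      p^[1+v]∣γ = ≋0⇒∣ℕ (≋-trans (≋-sym (val-stable γ N v<N)) p^[1+v]∣γN)

  γ-power-factor : ∀ n → Σ ℤ λ U → (+ val γ (suc n ℕ.* v)) ℤ.^ n ≡ + (p ^ (n ℕ.* v)) * U × Invertible q U
  γ-power-factor zero    = 1ℤ , refl , 1ℤ , ≋-refl {a = 1ℤ}
  γ-power-factor (suc n) with γ-unit-part (suc (suc n) ℕ.* v) v<N
    where
    v<N : suc v ≤ suc (suc n) ℕ.* v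
    v<N = ℕP.m<m+n v (ℕP.<-≤-trans (ℕ.>-nonZero⁻¹ v) (ℕP.m≤m+n v (n ℕ.* v)))
  ... | u , γ≡uq , p∤u = (+ u) ℤ.^ suc n , γ^n≡ , invertible-^ {a = + u} u-invertible (suc n)
    where
    u-invertible : Invertible q (+ u)
    u-invertible = coprime⇒invertible (coprime-^ʳ (∤-prime⇒coprime p-prime p∤u) v)

    open ≡-Reasoning
    γ^n≡ : (+ val γ (suc (suc n) ℕ.* v)) ℤ.^ suc n ≡ + (p ^ (suc n ℕ.* v)) * (+ u) ℤ.^ suc n
    γ^n≡ = begin
      (+ val γ (suc (suc n) ℕ.* v)) ℤ.^ suc n  ≡⟨ cong (λ r → (+ r) ℤ.^ suc n) γ≡uq ⟩
      (+ (u ℕ.* q)) ℤ.^ suc n                  ≡⟨ cong (ℤ._^ suc n) (ℤP.pos-* u q) ⟩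
      (+ u * + q) ℤ.^ suc n                    ≡⟨ ^-distribʳ-* (+ u) (+ q) (suc n) ⟩
      (+ u) ℤ.^ suc n * (+ q) ℤ.^ suc n        ≡⟨ ℤP.*-comm ((+ u) ℤ.^ suc n) _ ⟩
      (+ q) ℤ.^ suc n * (+ u) ℤ.^ suc n        ≡⟨ cong (_* (+ u) ℤ.^ suc n) (sym (pos-^ q (suc n))) ⟩
      + (q ^ suc n) * (+ u) ℤ.^ suc n          ≡⟨ cong (λ r → + r * (+ u) ℤ.^ suc n) q^n≡ ⟩
      + (p ^ (suc n ℕ.* v)) * (+ u) ℤ.^ suc n  ∎
      where
      q^n≡ : q ^ suc n ≡ p ^ (suc n ℕ.* v)
      q^n≡ = trans (ℕP.^-*-assoc p v (suc n)) (cong (p ^_) (ℕP.*-comm v (suc n)))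

  digit-coefficient : ∀ n → Σ ℤ λ D →
    (+ val γ (suc n ℕ.* v) - 1ℤ) * (+ val γ (suc n ℕ.* v)) ℤ.^ n ≡ D * + (p ^ (n ℕ.* v)) × Invertible q D
  digit-coefficient n with γ-power-factor n
  ... | U , γ^n≡ , U-invertible = (g - 1ℤ) * U , coefficient≡ , D-invertible
    where
    g : ℤ
    g = + val γ (suc n ℕ.* v)

    coefficient≡ : (g - 1ℤ) * g ℤ.^ n ≡ (g - 1ℤ) * U * + (p ^ (n ℕ.* v))
    coefficient≡ = trans (cong (_*_ (g - 1ℤ)) γ^n≡) (identity (g - 1ℤ) (+ (p ^ (n ℕ.* v))) U)
      where
      identity : ∀ h P U → h * (P * U) ≡ h * U * P
      identity = solve-∀

    D-invertible : Invertible q ((g - 1ℤ) * U)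
    D-invertible = invertible-* {a = g - 1ℤ} {U}
      (invertible-resp-≋ (≋-- (q∣γ (ℕP.m≤m+n v (n ℕ.* v))) (≋-refl {a = 1ℤ})) -1-invertible) U-invertible

  module _ (x : Zp p) where

    Approximates : ℕ → (ℕ → ℕ) → Set
    Approximates n c = + val x (n ℕ.* v) ≋ partialSum c (+ val γ (n ℕ.* v)) n [mod p ^ (n ℕ.* v) ]

    remainder-divisible : ∀ n c → Approximates n c →
      + (p ^ (n ℕ.* v)) ∣ℤ + val x (suc n ℕ.* v) - partialSum c (+ val γ (suc n ℕ.* v)) n
    remainder-divisible n c approx = ≋⇒∣ (begin
      + val x (v ℕ.+ N)                       ≈⟨ val-stable x (v ℕ.+ N) N≤v+N ⟩
      + val x N                               ≈⟨ approx ⟩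
      partialSum c (+ val γ N) n              ≈⟨ partialSum-cong c n (val-stable γ (v ℕ.+ N) N≤v+N) ⟨
      partialSum c (+ val γ (v ℕ.+ N)) n      ∎)
      where
      N : ℕ
      N = n ℕ.* v
      N≤v+N : N ≤ v ℕ.+ N
      N≤v+N = ℕP.m≤n+m N v
      open ≋-Reasoning (p ^ N)

    approximates-step : ∀ n c → Approximates n c → Σ ℕ λ d → d < q × Approximates (suc n) (extend c n d)
    approximates-step n c approx = d , d<q , x≋sum
      where
      N : ℕ
      N = n ℕ.* v

      g : ℤ
      g = + val γ (v ℕ.+ N)

      S : ℤ
      S = partialSum c g n

      D : ℤ
      D = proj₁ (digit-coefficient n)

      solution : Σ ℕ λ d → d < q × + val x (v ℕ.+ N) - S ≋ + d * D * + (p ^ N) [mod q ℕ.* p ^ N ]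
      solution = solve-linear-scaled q (p ^ N) (proj₂ (proj₂ (digit-coefficient n))) (remainder-divisible n c approx)

      d : ℕ
      d = proj₁ solution

      d<q : d < q
      d<q = proj₁ (proj₂ solution)

      x≋sum : Approximates (suc n) (extend c n d)
      x≋sum = subst (λ M → + val x (v ℕ.+ N) ≋ partialSum (extend c n d) g (suc n) [mod M ])
        (sym (ℕP.^-distribˡ-+-* p v N)) (begin
        + val x (v ℕ.+ N)                      ≡⟨ identity (+ val x (v ℕ.+ N)) S ⟩
        S + (+ val x (v ℕ.+ N) - S)            ≈⟨ ≋-+ (≋-refl {a = S}) (proj₂ (proj₂ solution)) ⟩
        S + + d * D * + (p ^ N)                ≡⟨ cong (_+_ S) (ℤP.*-assoc (+ d) D _) ⟩
        S + + d * (D * + (p ^ N))              ≡⟨ cong (λ z → S + + d * z) (proj₁ (proj₂ (digit-coefficient n))) ⟨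
        S + + d * ((g - 1ℤ) * g ℤ.^ n)         ≡⟨ cong (_+_ S) (ℤP.*-assoc (+ d) (g - 1ℤ) _) ⟨
        S + + d * (g - 1ℤ) * g ℤ.^ n           ≡⟨ partialSum-extend c g n d ⟨
        partialSum (extend c n d) g (suc n)    ∎)
        where
        open ≋-Reasoning (q ℕ.* p ^ N)
        identity : ∀ x s → x ≡ s + (x - s)
        identity = solve-∀

    module Digits = DependentChoice (_< q) Approximates
      (λ n c≡c′ approx → ≋-trans approx (≋-reflexive (partialSum-local _ n c≡c′)))
      (λ _ → 0) ≋-mod-1 approximates-step

    summand : Fin (q ∸ 1) → ℕ → Bool
    summand i n = toℕ i <ᵇ Digits.sequence n

    summands-sum : ∀ m → sumFin (q ∸ 1) (λ i → + val (cantorPoint (summand i)) m) ≋ + val x m [mod p ^ m ]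
    summands-sum m = begin
      sumFin (q ∸ 1) (λ i → + val (cantorPoint (summand i)) m)
        ≈⟨ sumFin-cong (q ∸ 1) (λ i → cantorPoint-val (summand i) m) ⟩
      sumFin (q ∸ 1) (λ i → cantorSum (summand i) (+ val γ m) m)
        ≡⟨ cantorSum-indicator (q ∸ 1) Digits.sequence (+ val γ m) m digit≤q-1 ⟩
      partialSum Digits.sequence (+ val γ m) m
        ≈⟨ partialSum-cong Digits.sequence m (val-stable γ (m ℕ.* v) m≤mv) ⟨
      partialSum Digits.sequence (+ val γ (m ℕ.* v)) m
        ≈⟨ ≋-weaken (^-monoʳ-∣ p m≤mv) (Digits.sequence-P m) ⟨
      + val x (m ℕ.* v)
        ≈⟨ val-stable x (m ℕ.* v) m≤mv ⟩
      + val x m ∎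
      where
      open ≋-Reasoning (p ^ m)
      m≤mv : m ≤ m ℕ.* v
      m≤mv = ℕP.m≤m*n m v
      digit≤q-1 : ∀ n → Digits.sequence n ≤ q ∸ 1
      digit≤q-1 n = ℕP.<⇒≤pred (Digits.sequence-Q n)

    decomposition : IsSumOfCantor p γ (q ∸ 1) x
    decomposition = (λ i → cantorPoint (summand i)) , (λ i → cantorPoint∈𝒞 (summand i)) ,
              (λ m → ≋⇒≡-mod (≋-sym (summands-sum m)))

  covers : Covers p γ (q ∸ 1)
  covers = decomposition

theorem7p1 : (p : ℕ) → Prime p → (γ : Zp p) → (v : ℕ) →
    HasValuation p γ v → val γ 1 ≡ 0 → 2 < p ^ v →
    (0 < p ^ v ∸ 1) × Covers p γ (p ^ v ∸ 1) ×
    (∀ k → 0 < k → k < p ^ v ∸ 1 → ¬ Covers p γ k)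
theorem7p1 p p-prime γ zero    (_ , γ₁≢0) γ₁≡0 _   = ⊥-elim (γ₁≢0 γ₁≡0)
theorem7p1 p p-prime γ v@(suc _) γ-valuation γ₁≡0 2<q =
  ℕP.m<n⇒0<n∸m (ℕP.<-trans (ℕP.n<1+n 1) 2<q) ,
  Expansion.covers p-prime γ v γ-valuation γ₁≡0 ,
  λ k _ → LowerBound.¬covers (ℕ.nonTrivial⇒n>1 p {{prime⇒nonTrivial p-prime}}) γ v (proj₁ γ-valuation) k
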